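{- Let $K$ be an $n$-vertex $\{p,q\}$-equivelar map on a surface $S$ and let $M$ be its dual map. If $\frac{n-2}{p-2}$ is not an integer, then $M$ does not have any admissible proper tree.
   Context: A surface is a connected compact 2-manifold without boundary. A map on $S$ is an embedding of a finite simple graph whose complementary components have closures that are polygonal 2-disks (facets/faces), and it is polyhedral if any two facets meet in the empty set, a vertex, or an edge (here "map" means polyhedral map). It is $\{p,q\}$-equivelar ($p,q\ge3$) if every facet is a $p$-gon and every vertex lies in exactly $q$ facets. The dual map $M$ of $K$ has the facets of $K$ as vertices, two joined iff the facets share an edge; faces of $M$ correspond to vertices of $K$. $EG(\cdot)$ denotes the edge graph. A tree $T$ in $EG(M)$ with vertex set $\{v_1,\dots,v_k\}$ is a proper tree if: (1) $\sum_{i=1}^k\deg(v_i)=n+2(k-1)$ (degrees in $EG(M)$); (2) whenever two vertices $u_1,u_2$ of $T$ lie on a face $F$ of $M$, a path joining them in $\partial F$ is part of $T$; (3) every path in $T$ lying in a face $F$ of $M$ has length at most $q-2$, where $q$ is the length of $\partial F$. The dual disc $D$ of $T$ is the union of the facets of $K$ corresponding to the vertices of $T$; a proper tree is admissible if the boundary of $D$ is a Hamiltonian cycle in $EG(K)$. -}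

module Defs where

open import Data.Nat using (ℕ; zero; suc; _+_; _*_; _∸_; _≤_)
open import Data.Nat.DivMod using (_%_; m%n<n)
open import Data.Fin using (Fin; toℕ; fromℕ<)
open import Data.List using (List; length; head; last)
open import Data.Nat.ListAction using (sum)
import Data.List as List
open import Data.List.Relation.Unary.All using (All)
open import Data.List.Relation.Unary.Linked using (Linked)
open import Data.List.Relation.Unary.Unique.Propositional using (Unique)
open import Data.Maybe using (just)
open import Data.Product using (Σ; ∃; ∃₂; _×_; _,_)
open import Data.Sum using (_⊎_)
open import Data.Empty using (⊥)
open import Function.Definitions using (Injective)
open import Relation.Binary.PropositionalEquality using (_≡_; _≢_)
open import Relation.Binary.Construct.Closure.ReflexiveTransitive using (Star)

next : ∀ {m} → Fin m → Fin m
next {suc m} i = fromℕ< (m%n<n (suc (toℕ i)) (suc m))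

Count : ∀ {m} → (Fin m → Set) → ℕ → Set
Count {m} P c = Σ (Fin c → Fin m) λ g →
  Injective _≡_ _≡_ g × (∀ j → P (g j)) × (∀ x → P x → ∃ λ j → g j ≡ x)

IsPath : ∀ {A : Set} → (A → A → Set) → A → A → List A → Set
IsPath R a b xs = Unique xs × Linked R xs × head xs ≡ just a × last xs ≡ just b

-- Combinatorial data of a 2-dimensional cell structure with vertex set Fin n:
-- facets Fin nf, facet x is the polygon with cyclically ordered corners
-- corner x 0, corner x 1, ..., corner x (size x - 1).
record PolyhedralMap (n : ℕ) : Set where
  field
    nf     : ℕ
    size   : Fin nf → ℕ
    corner : (x : Fin nf) → Fin (size x) → Fin n

module _ {n : ℕ} (K : PolyhedralMap n) where
  open PolyhedralMap K

  OnFacet : Fin n → Fin nf → Set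
  OnFacet v x = ∃ λ i → corner x i ≡ v

  DirEdge : Fin nf → Fin n → Fin n → Set
  DirEdge x u w = ∃ λ i → corner x i ≡ u × corner x (next i) ≡ w

  EdgeOf : Fin nf → Fin n → Fin n → Set
  EdgeOf x u w = DirEdge x u w ⊎ DirEdge x w u

  KAdj : Fin n → Fin n → Set
  KAdj u w = ∃ λ x → EdgeOf x u w

  -- adjacency in EG(M), M the dual map: distinct facets sharing an edge
  MAdj : Fin nf → Fin nf → Set
  MAdj x y = x ≢ y × ∃₂ λ u w → EdgeOf x u w × EdgeOf y u w

  -- edges of the boundary cycle of the face F_v of M dual to the vertex v:
  -- distinct facets sharing an edge through v
  LinkAdj : Fin n → Fin nf → Fin nf → Set
  LinkAdj v x y = x ≢ y × ∃ λ w → EdgeOf x v w × EdgeOf y v w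

  record IsPolyhedralMap : Set where
    field
      facet-size     : ∀ x → 3 ≤ size x
      facet-inj      : ∀ x → Injective _≡_ _≡_ (corner x)
      vertex-used    : ∀ v → ∃ λ x → OnFacet v x
      edge-two       : ∀ u w → KAdj u w → ∃₂ λ x y → x ≢ y × EdgeOf x u w × EdgeOf y u w
                         × (∀ z → EdgeOf z u w → z ≡ x ⊎ z ≡ y)
      link-connected : ∀ v x y → OnFacet v x → OnFacet v y → Star (LinkAdj v) x y
      polyhedral-two : ∀ x y → x ≢ y → ∀ u w → u ≢ w → OnFacet u x → OnFacet u y
                         → OnFacet w x → OnFacet w y → EdgeOf x u w × EdgeOf y u w
      polyhedral-three : ∀ x y → x ≢ y → ∀ u w z → u ≢ w → u ≢ z → w ≢ z
                         → OnFacet u x → OnFacet u y → OnFacet w x → OnFacet w y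
                         → OnFacet z x → OnFacet z y → ⊥
      connected      : ∀ u w → Star KAdj u w

  IsEquivelar : ℕ → ℕ → Set
  IsEquivelar p q = 3 ≤ p × 3 ≤ q × (∀ x → size x ≡ p) × (∀ v → Count (OnFacet v) q)

  record Tree (k : ℕ) : Set₁ where
    field
      vs        : Fin k → Fin nf
      vs-inj    : Injective _≡_ _≡_ vs
      nonempty  : 1 ≤ k
      E         : Fin nf → Fin nf → Set
      E-adj     : ∀ x y → E x y → MAdj x y
      E-sym     : ∀ x y → E x y → E y x
      E-in      : ∀ x y → E x y → (∃ λ i → vs i ≡ x) × (∃ λ j → vs j ≡ y)
      connected : ∀ i j → Star E (vs i) (vs j)
      acyclic   : ∀ xs → Unique xs → 3 ≤ length xs → Linked E xs
                    → ∀ a b → head xs ≡ just a → last xs ≡ just b → E b a → ⊥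

  module _ {k : ℕ} (T : Tree k) where
    open Tree T

    InT : Fin nf → Set
    InT x = ∃ λ i → vs i ≡ x

    record IsProperTree : Set where
      field
        degree-sum : ∃ λ (d : Fin k → ℕ) → (∀ i → Count (MAdj (vs i)) (d i))
                       × sum (List.tabulate d) ≡ n + 2 * (k ∸ 1)
        face-path  : ∀ i j v → OnFacet v (vs i) → OnFacet v (vs j)
                       → ∃ λ xs → IsPath (λ a b → LinkAdj v a b × E a b) (vs i) (vs j) xs
                                  × All InT xs
        face-short : ∀ v c → Count (λ x → OnFacet v x) c
                       → ∀ xs → Unique xs → Linked (λ a b → E a b × LinkAdj v a b) xs
                       → All (OnFacet v) xs → length xs ∸ 1 ≤ c ∸ 2

    -- {u,w} is a boundary edge of the dual disc D: it lies in exactly one facet of T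
    BoundaryEdge : Fin n → Fin n → Set
    BoundaryEdge u w = ∃ λ i → EdgeOf (vs i) u w × (∀ j → EdgeOf (vs j) u w → j ≡ i)

    -- the boundary of D is a Hamiltonian cycle c 0, c 1, ..., c (n-1) of EG(K)
    IsAdmissible : Set
    IsAdmissible = ∃ λ (c : Fin n → Fin n) → 3 ≤ n × Injective _≡_ _≡_ c
      × (∀ v → ∃ λ i → c i ≡ v) × (∀ i → KAdj (c i) (c (next i)))
      × (∀ u w → (BoundaryEdge u w → CycEdge c u w) × (CycEdge c u w → BoundaryEdge u w))
      where
        CycEdge : (Fin n → Fin n) → Fin n → Fin n → Set
        CycEdge c u w = ∃ λ i → (c i ≡ u × c (next i) ≡ w) ⊎ (c i ≡ w × c (next i) ≡ u)

module Submission where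

open import Defs
open import Data.Nat using (ℕ; _∸_; zero; suc; _+_; _*_; _≤_; _<?_; z≤n; s≤s)
open import Data.Nat.Properties
  using (≤-antisym; <⇒≱; ≤-trans; n≤1+n; ≮⇒≥; 1+n≢n; m≢1+n+m; +-identityʳ; +-cancelʳ-≡; m+n∸n≡m)
open import Data.Nat.DivMod using (_%_; m<n⇒m%n≡m; n%n≡0)
open import Data.Nat.Divisibility using (_∣_; divides; _∣0)
open import Data.Nat.ListAction using (sum)
open import Data.Nat.Tactic.RingSolver using (solve-∀)
open import Data.List using (tabulate)
open import Data.Fin using (Fin; toℕ; _≟_)
import Data.Fin as Fin
open import Data.Fin.Properties using (toℕ<n; toℕ-fromℕ<; cantor-schröder-bernstein)
open import Data.Product using (Σ; ∃; _×_; _,_; proj₁; proj₂)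
open import Data.Sum using (_⊎_; inj₁; inj₂)
open import Data.Empty using (⊥-elim)
open import Relation.Nullary using (¬_; yes; no)
open import Function.Definitions using (Injective)
open import Function using (_∘_)
open import Relation.Binary.PropositionalEquality using (_≡_; _≢_; ≢-sym; refl; sym; trans; cong; cong₂; subst)

-- In the dual map M every facet x of K has exactly size x = p neighbours: one across each
-- of its edges, and the polyhedral condition (two facets share at most two vertices) makes
-- these neighbours distinct. So for a proper tree on k vertices, condition (1) reads
-- k p = n + 2 (k - 1), i.e. n - 2 = k (p - 2).

CyclicStep : ℕ → ℕ → ℕ → Set
CyclicStep s t t′ = t′ ≡ suc t ⊎ (t′ ≡ 0 × suc t ≡ s)

toℕ-next : ∀ {s} (i : Fin s) → CyclicStep s (toℕ i) (toℕ (next i))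
toℕ-next {suc m} i with suc (toℕ i) <? suc m
... | yes i+1<s = inj₁ (trans (toℕ-fromℕ< _) (m<n⇒m%n≡m i+1<s))
... | no i+1≮s = inj₂ (trans (toℕ-fromℕ< _) (trans (cong (_% suc m) i+1≡s) (n%n≡0 (suc m))) , i+1≡s)
  where
  i+1≡s : suc (toℕ i) ≡ suc m
  i+1≡s = ≤-antisym (toℕ<n i) (≮⇒≥ i+1≮s)

cyclicStep-returns : ∀ {s t t₁} → CyclicStep s t t₁ → t₁ ≡ t → s ≤ 1
cyclicStep-returns (inj₁ refl) eq = ⊥-elim (1+n≢n eq)
cyclicStep-returns (inj₂ (refl , refl)) refl = s≤s z≤n

cyclicStep²-returns : ∀ {s t t₁ t₂} → CyclicStep s t t₁ → CyclicStep s t₁ t₂ → t₂ ≡ t → s ≤ 2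
cyclicStep²-returns (inj₁ refl) (inj₁ refl) eq = ⊥-elim (m≢1+n+m _ (sym eq))
cyclicStep²-returns (inj₁ refl) (inj₂ (refl , refl)) refl = s≤s (s≤s z≤n)
cyclicStep²-returns (inj₂ (refl , refl)) (inj₁ refl) refl = s≤s (s≤s z≤n)
cyclicStep²-returns (inj₂ (refl , refl)) (inj₂ (refl , refl)) _ = s≤s z≤n

next-≢ : ∀ {s} → 2 ≤ s → (i : Fin s) → next i ≢ i
next-≢ 2≤s i eq = <⇒≱ 2≤s (cyclicStep-returns (toℕ-next i) (cong toℕ eq))

next²-≢ : ∀ {s} → 3 ≤ s → (i : Fin s) → next (next i) ≢ i
next²-≢ 3≤s i eq = <⇒≱ 3≤s (cyclicStep²-returns (toℕ-next i) (toℕ-next (next i)) (cong toℕ eq))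

Count-embed : ∀ {m} {P : Fin m → Set} {c c′} → Count P c → Count P c′
            → Σ (Fin c → Fin c′) (Injective _≡_ _≡_)
Count-embed {c = c} {c′} (g , g-inj , gP , _) (h , _ , _ , h-onto) =
  h⁻¹∘g , λ {i} {j} eq → g-inj (trans (sym (h∘h⁻¹∘g i)) (trans (cong h eq) (h∘h⁻¹∘g j)))
  where
  h⁻¹∘g : Fin c → Fin c′
  h⁻¹∘g j = proj₁ (h-onto (g j) (gP j))
  h∘h⁻¹∘g : ∀ j → h (h⁻¹∘g j) ≡ g j
  h∘h⁻¹∘g j = proj₂ (h-onto (g j) (gP j))

Count-unique : ∀ {m} {P : Fin m → Set} {c c′} → Count P c → Count P c′ → c ≡ c′
Count-unique P#c P#c′ =
  cantor-schröder-bernstein (proj₂ (Count-embed P#c P#c′)) (proj₂ (Count-embed P#c′ P#c))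

module _ {n} {K : PolyhedralMap n} (H : IsPolyhedralMap K) where
  open PolyhedralMap K
  open IsPolyhedralMap H

  EdgeOf-sym : ∀ {x u w} → EdgeOf K x u w → EdgeOf K x w u
  EdgeOf-sym (inj₁ e) = inj₂ e
  EdgeOf-sym (inj₂ e) = inj₁ e

  EdgeOf⇒OnFacetˡ : ∀ {x u w} → EdgeOf K x u w → OnFacet K u x
  EdgeOf⇒OnFacetˡ (inj₁ (i , uᵢ , _)) = i , uᵢ
  EdgeOf⇒OnFacetˡ (inj₂ (i , _ , uᵢ₊₁)) = next i , uᵢ₊₁

  EdgeOf⇒OnFacetʳ : ∀ {x u w} → EdgeOf K x u w → OnFacet K w x
  EdgeOf⇒OnFacetʳ = EdgeOf⇒OnFacetˡ ∘ EdgeOf-sym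

  module _ (x : Fin nf) where
    Across : Fin (size x) → Set
    Across i = Σ (Fin nf) λ y → y ≢ x × EdgeOf K y (corner x i) (corner x (next i))
                 × (∀ z → EdgeOf K z (corner x i) (corner x (next i)) → z ≡ x ⊎ z ≡ y)

    ownEdge : ∀ i → EdgeOf K x (corner x i) (corner x (next i))
    ownEdge i = inj₁ (i , refl , refl)

    across : ∀ i → Across i
    across i with edge-two _ _ (x , ownEdge i)
    ... | y₀ , y₁ , y₀≢y₁ , e₀ , e₁ , only with y₀ ≟ x
    ...   | yes refl = y₁ , ≢-sym y₀≢y₁ , e₁ , only
    ...   | no y₀≢x = y₀ , y₀≢x , e₀ , λ z e → swap (only z e)
      where
      swap : ∀ {z} → z ≡ y₀ ⊎ z ≡ y₁ → z ≡ x ⊎ z ≡ y₀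
      swap (inj₁ z≡y₀) = inj₂ z≡y₀
      swap (inj₂ z≡y₁) with only x (ownEdge i)
      ... | inj₁ x≡y₀ = ⊥-elim (y₀≢x (sym x≡y₀))
      ... | inj₂ x≡y₁ = inj₁ (trans z≡y₁ (sym x≡y₁))

    facetAcross : Fin (size x) → Fin nf
    facetAcross i = proj₁ (across i)

    facetAcross-≢ : ∀ i → facetAcross i ≢ x
    facetAcross-≢ i = proj₁ (proj₂ (across i))

    facetAcross-edge : ∀ i → EdgeOf K (facetAcross i) (corner x i) (corner x (next i))
    facetAcross-edge i = proj₁ (proj₂ (proj₂ (across i)))

    facetAcross-unique : ∀ i y → x ≢ y → EdgeOf K y (corner x i) (corner x (next i))
                       → facetAcross i ≡ y
    facetAcross-unique i y x≢y e with proj₂ (proj₂ (proj₂ (across i))) y e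
    ... | inj₁ y≡x = ⊥-elim (x≢y (sym y≡x))
    ... | inj₂ y≡ = sym y≡

    2≤size : 2 ≤ size x
    2≤size = ≤-trans (n≤1+n 2) (facet-size x)

    corner-≢ : ∀ {i j} → i ≢ j → corner x i ≢ corner x j
    corner-≢ i≢j = i≢j ∘ facet-inj x

    -- If edges i ≢ j of x have the same neighbour, it contains corner j, and corner next j
    -- when j = next i; either way a corner of x other than those of edge i.
    thirdSharedCorner : ∀ {i j} → facetAcross i ≡ facetAcross j → i ≢ j
                      → ∃ λ l → l ≢ i × l ≢ next i × OnFacet K (corner x l) (facetAcross i)
    thirdSharedCorner {i} {j} same i≢j with j ≟ next i
    ... | no j≢i+1 = j , ≢-sym i≢j , j≢i+1 ,
          subst (OnFacet K (corner x j)) (sym same) (EdgeOf⇒OnFacetˡ (facetAcross-edge j))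
    ... | yes refl = next j , next²-≢ (facet-size x) i , next-≢ 2≤size (next i) ,
          subst (OnFacet K (corner x (next j))) (sym same) (EdgeOf⇒OnFacetʳ (facetAcross-edge j))

    facetAcross-injective : Injective _≡_ _≡_ facetAcross
    facetAcross-injective {i} {j} same with i ≟ j
    ... | yes i≡j = i≡j
    ... | no i≢j with thirdSharedCorner same i≢j
    ...   | l , l≢i , l≢i+1 , onFacetₗ = ⊥-elim
      (polyhedral-three x (facetAcross i) (≢-sym (facetAcross-≢ i))
        (corner x i) (corner x (next i)) (corner x l)
        (corner-≢ (≢-sym (next-≢ 2≤size i))) (corner-≢ (≢-sym l≢i)) (corner-≢ (≢-sym l≢i+1))
        (i , refl) (EdgeOf⇒OnFacetˡ (facetAcross-edge i))
        (next i , refl) (EdgeOf⇒OnFacetʳ (facetAcross-edge i))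
        (l , refl) onFacetₗ)

  MAdj-count : ∀ x → Count (MAdj K x) (size x)
  MAdj-count x = facetAcross x , facetAcross-injective x , adjacent , onto
    where
    adjacent : ∀ i → MAdj K x (facetAcross x i)
    adjacent i = ≢-sym (facetAcross-≢ x i) , _ , _ , ownEdge x i , facetAcross-edge x i
    onto : ∀ y → MAdj K x y → ∃ λ i → facetAcross x i ≡ y
    onto y (x≢y , _ , _ , inj₁ (i , refl , refl) , e) = i , facetAcross-unique x i y x≢y e
    onto y (x≢y , _ , _ , inj₂ (i , refl , refl) , e) = i , facetAcross-unique x i y x≢y (EdgeOf-sym e)

sum-tabulate-const : ∀ {k c} (d : Fin k → ℕ) → (∀ i → d i ≡ c) → sum (tabulate d) ≡ k * c
sum-tabulate-const {zero} d d≡c = refl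
sum-tabulate-const {suc k} d d≡c =
  cong₂ _+_ (d≡c Fin.zero) (sum-tabulate-const (d ∘ Fin.suc) (d≡c ∘ Fin.suc))

degreeSum⇒∣ : ∀ n p k → 2 ≤ p → k * p ≡ n + 2 * (k ∸ 1) → (p ∸ 2) ∣ (n ∸ 2)
degreeSum⇒∣ n (suc (suc r)) zero (s≤s (s≤s _)) 0≡n+0 =
  subst (λ m → r ∣ m ∸ 2) (trans 0≡n+0 (+-identityʳ n)) (r ∣0)
degreeSum⇒∣ n (suc (suc r)) (suc k) (s≤s (s≤s _)) eq = divides (suc k) (sym n∸2≡)
  where
  expand : ∀ k r → suc k * suc (suc r) ≡ (suc k * r + 2) + 2 * k
  expand = solve-∀
  n≡ : suc k * r + 2 ≡ n
  n≡ = +-cancelʳ-≡ (2 * k) _ n (trans (sym (expand k r)) eq)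
  n∸2≡ : suc k * r ≡ n ∸ 2
  n∸2≡ = trans (sym (m+n∸n≡m (suc k * r) 2)) (cong (_∸ 2) n≡)

-- Only condition (1) of a proper tree is needed.
lemma4 : (n p q : ℕ) (K : PolyhedralMap n) → IsPolyhedralMap K → IsEquivelar K p q
       → ¬ ((p ∸ 2) ∣ (n ∸ 2))
       → (k : ℕ) (T : Tree K k) → IsProperTree K T → ¬ IsAdmissible K T
lemma4 n p q K H (3≤p , _ , p-gons , _) p∸2∤n∸2 k T proper _
  with IsProperTree.degree-sum proper
... | d , d-count , Σd≡ =
  p∸2∤n∸2 (degreeSum⇒∣ n p k (≤-trans (n≤1+n 2) 3≤p) (trans (sym (sum-tabulate-const d d≡p)) Σd≡))
  where
  d≡p : ∀ i → d i ≡ p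
  d≡p i = trans (Count-unique (d-count i) (MAdj-count H (Tree.vs T i))) (p-gons (Tree.vs T i))
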